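{- Every $2$-syndetic set $A\subset\mathbb{N}$ contains infinitely many $2$-term geometric progressions whose common ratios are perfect squares, i.e. there are infinitely many two-element sets of the form $\{x, xr^2\}$ with $x,r\in\mathbb{N}$ contained in $A$.
   Context: $\mathbb{N}=\{1,2,3,\dots\}$. A set $A\subset\mathbb{N}$ is $2$-syndetic if it has nonempty intersection with every set of $2$ consecutive natural numbers, i.e. for every $n\in\mathbb{N}$ at least one of $n,n+1$ lies in $A$. -}

module Defs where

open import Data.Nat using (ℕ; suc; _+_; _*_; _≤_; _<_)
open import Data.Product using (∃-syntax; _×_)
open import Data.Sum using (_⊎_)

-- Subsets of ℕ = {1,2,3,...} are modelled as predicates on Agda's ℕ;
-- only arguments n ≥ 1 are ever relevant.

TwoSyndetic : (ℕ → Set) → Set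
TwoSyndetic A = ∀ n → 1 ≤ n → A n ⊎ A (suc n)

-- {x, x r²} is a two-element set (x, r ∈ ℕ≥1, x ≠ x r², i.e. r ≥ 2) contained in A.
SquareRatioGP2 : (ℕ → Set) → ℕ → ℕ → Set
SquareRatioGP2 A x r = 1 ≤ x × 2 ≤ r × A x × A (x * (r * r))

-- Infinitely many such sets: a family of finite subsets of ℕ is infinite
-- iff their maxima are unbounded; the maximum of {x, x r²} is x r².
InfinitelyManySquareRatioGP2 : (ℕ → Set) → Set
InfinitelyManySquareRatioGP2 A =
  ∀ N → ∃[ x ] ∃[ r ] (SquareRatioGP2 A x r × N < x * (r * r))

module Submission where

-- For v ≥ 1 put  next v = v (4v+3)².  The polynomial
-- identity
--     v (4v+3)² + 1 = (v+1) (4v+1)²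
-- says that the pair of consecutive numbers (v, v+1) is mapped to the pair
-- (next v, next v + 1) by multiplying each member by a square with root ≥ 2.
-- Call such pairs of starting points "linked"; linkedness is transitive.
-- Take v₀ = N+1, v₁ = next v₀, v₂ = next v₁: the three pairs (vᵢ, vᵢ+1) are
-- pairwise linked.  A 2-syndetic set A meets each pair, say on the left or
-- on the right member; by pigeonhole two of the three pairs are met on the
-- same side, and the two members of A found there form a set {x, x r²} with
-- r ≥ 2 whose maximum exceeds N.

open import Data.Nat using (ℕ; suc; _+_; _*_; _≤_; _<_; z≤n; s≤s)
open import Data.Nat.Properties using (*-mono-≤; m≤m*n; m≤n+m; +-mono-≤; ≤-refl; ≤-trans; <-≤-trans; n≤1+n; m≤m+n)
open import Data.Nat.Tactic.RingSolver using (solve-∀)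
open import Data.Product using (_,_; _×_; ∃-syntax; proj₁)
open import Data.Sum using (_⊎_; inj₁; inj₂; [_,_]′)
open import Relation.Binary.PropositionalEquality using (_≡_; sym; subst)
open import Defs

data SquareMultiple (x : ℕ) : ℕ → Set where
  byRoot : ∀ r → 2 ≤ r → SquareMultiple x (x * (r * r))

squareMultiple-≤ : ∀ {x y} → SquareMultiple x y → x ≤ y
squareMultiple-≤ {x} (byRoot (suc (suc r)) (s≤s (s≤s _))) = m≤m*n x (suc (suc r) * suc (suc r))

squareMultiple-trans : ∀ {x y z} → SquareMultiple x y → SquareMultiple y z → SquareMultiple x z
squareMultiple-trans {x} (byRoot r 2≤r) (byRoot s 2≤s) =
  subst (SquareMultiple x) (sym (regroup x r s))
        (byRoot (r * s) (*-mono-≤ 2≤r (≤-trans (s≤s z≤n) 2≤s)))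
  where
    regroup : ∀ x r s → (x * (r * r)) * (s * s) ≡ x * ((r * s) * (r * s))
    regroup = solve-∀

Linked : ℕ → ℕ → Set
Linked v w = SquareMultiple v w × SquareMultiple (suc v) (suc w)

linked-trans : ∀ {u v w} → Linked u v → Linked v w → Linked u w
linked-trans (l , r) (l′ , r′) = squareMultiple-trans l l′ , squareMultiple-trans r r′

next : ℕ → ℕ
next v = v * ((4 * v + 3) * (4 * v + 3))

next-suc : ∀ v → suc (v * ((4 * v + 3) * (4 * v + 3))) ≡ suc v * ((4 * v + 1) * (4 * v + 1))
next-suc = solve-∀

-- For v ≥ 1 both square roots 4v+3 and 4v+1 are at least 2.
linked-next : ∀ {v} → 1 ≤ v → Linked v (next v)
linked-next {v} 1≤v =
  byRoot (4 * v + 3) (≤-trans (n≤1+n 2) (m≤n+m 3 (4 * v))) ,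
  subst (SquareMultiple (suc v)) (sym (next-suc v))
        (byRoot (4 * v + 1) (+-mono-≤ (≤-trans 1≤v (m≤m+n v _)) (≤-refl {1})))

GPAbove : (ℕ → Set) → ℕ → Set
GPAbove A N = ∃[ x ] ∃[ r ] (SquareRatioGP2 A x r × N < x * (r * r))

gpAbove : ∀ {A N x y} → N < x → SquareMultiple x y → A x → A y → GPAbove A N
gpAbove {x = x} N<x m@(byRoot r 2≤r) ax ay =
  x , r , (≤-trans (s≤s z≤n) N<x , 2≤r , ax , ay) , <-≤-trans N<x (squareMultiple-≤ m)

gpAboveLinked : ∀ {A N v w} → N < v → Linked v w →
                (A v × A w) ⊎ (A (suc v) × A (suc w)) → GPAbove A N
gpAboveLinked N<v (l , _) (inj₁ (av , aw)) = gpAbove N<v l av aw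
gpAboveLinked N<v (_ , r) (inj₂ (av , aw)) = gpAbove (≤-trans N<v (n≤1+n _)) r av aw

pigeonhole : ∀ {P₀ Q₀ P₁ Q₁ P₂ Q₂ : Set} → P₀ ⊎ Q₀ → P₁ ⊎ Q₁ → P₂ ⊎ Q₂ →
             (P₀ × P₁ ⊎ Q₀ × Q₁) ⊎ (P₀ × P₂ ⊎ Q₀ × Q₂) ⊎ (P₁ × P₂ ⊎ Q₁ × Q₂)
pigeonhole (inj₁ p₀) (inj₁ p₁) _         = inj₁ (inj₁ (p₀ , p₁))
pigeonhole (inj₂ q₀) (inj₂ q₁) _         = inj₁ (inj₂ (q₀ , q₁))
pigeonhole (inj₁ p₀) (inj₂ _)  (inj₁ p₂) = inj₂ (inj₁ (inj₁ (p₀ , p₂)))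
pigeonhole (inj₂ q₀) (inj₁ _)  (inj₂ q₂) = inj₂ (inj₁ (inj₂ (q₀ , q₂)))
pigeonhole (inj₁ _)  (inj₂ q₁) (inj₂ q₂) = inj₂ (inj₂ (inj₂ (q₁ , q₂)))
pigeonhole (inj₂ _)  (inj₁ p₁) (inj₁ p₂) = inj₂ (inj₂ (inj₁ (p₁ , p₂)))

theorem1p9 : (A : ℕ → Set) → TwoSyndetic A → InfinitelyManySquareRatioGP2 A
theorem1p9 A syndetic N =
  [ gpAboveLinked N<v₀ link₀₁
  , [ gpAboveLinked N<v₀ (linked-trans link₀₁ link₁₂)
    , gpAboveLinked N<v₁ link₁₂ ]′ ]′
  (pigeonhole (syndetic v₀ 1≤v₀) (syndetic v₁ 1≤v₁) (syndetic v₂ 1≤v₂))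
  where
    v₀ v₁ v₂ : ℕ
    v₀ = suc N
    v₁ = next v₀
    v₂ = next v₁
    1≤v₀ : 1 ≤ v₀
    1≤v₀ = s≤s z≤n
    N<v₀ : N < v₀
    N<v₀ = ≤-refl
    link₀₁ : Linked v₀ v₁
    link₀₁ = linked-next 1≤v₀
    1≤v₁ : 1 ≤ v₁
    1≤v₁ = ≤-trans 1≤v₀ (squareMultiple-≤ (proj₁ link₀₁))
    N<v₁ : N < v₁
    N<v₁ = <-≤-trans N<v₀ (squareMultiple-≤ (proj₁ link₀₁))
    link₁₂ : Linked v₁ v₂
    link₁₂ = linked-next 1≤v₁
    1≤v₂ : 1 ≤ v₂
    1≤v₂ = ≤-trans 1≤v₁ (squareMultiple-≤ (proj₁ link₁₂))
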